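{- Fix an integer $m\ge 1$ and $n\ge 0$. Let $\pi$ be a set partition of $[n]=\{1,\dots,n\}$ containing no $(m+1)$-nesting, with label $L(\pi)=(a_1,\dots,a_m)$. Then exactly $a_m$ of the set partitions of $[n+1]$ that arise from $\pi$ by adding the element $n+1$ (either as a new singleton block, or into one of the blocks of $\pi$) contain no $(m+1)$-nesting: namely the partition obtained by adding $n+1$ as a singleton, and, for each $l$ with $1\le l\le a_m-1$, the partition obtained by adding $n+1$ to block $l$ of $\pi$. Their labels are as follows: \begin{itemize} \item adding $n+1$ as a singleton gives label $(a_1+1,a_2+1,\dots,a_m+1)$; \item adding $n+1$ to block $l$ with $1\le l\le a_1-1$ gives label $(l+1,a_2,a_3,\dots,a_m)$; \item for $2\le j\le m$, adding $n+1$ to block $l$ with $a_{j-1}\le l\le a_j-1$ gives label $(a_1+1,\dots,a_{j-1}+1,\,l+1,\,a_{j+1},\dots,a_m)$. \end{itemize}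
   Context: A set partition of $[n]$ is a collection of nonempty, pairwise disjoint blocks whose union is $[n]$ ($n=0$ gives the empty partition). Its standard representation is the graph on vertex set $[n]$ whose edges (arcs) join consecutive elements of each block in numerical order, i.e. $(i,j)$ is an arc iff $i<j$ lie in the same block and no element of that block lies strictly between them. A $k$-nesting is a collection of $k$ arcs $(i_1,j_1),\dots,(i_k,j_k)$ with $i_1<i_2<\dots<i_k<j_k<j_{k-1}<\dots<j_1$ (a single arc is a $1$-nesting); a partition is $k$-nonnesting if it has no $k$-nesting. The blocks of a partition are numbered $1,2,3,\dots$ in decreasing order of their maximal elements (block $1$ contains the largest element). "Adding $n+1$ to block $l$" means forming the partition of $[n+1]$ in which $n+1$ is put into block $l$ of $\pi$ (so a new arc from the maximal element of block $l$ to $n+1$ is created). The label of $\pi$ (for fixed $m$) is $L(\pi)=(a_1(\pi),\dots,a_m(\pi))$ where, for $1\le j\le m$, $a_j(\pi)$ equals $1+$ (number of blocks of $\pi$) if $\pi$ is $j$-nonnesting, and otherwise equals $1+$ the number of blocks whose maximal element is strictly greater than $v_j$, where $v_j$ is the largest value, over all $j$-nestings of $\pi$, of the smallest vertex $i_1$ of the $j$-nesting (the smallest vertex of the "rightmost" $j$-nesting). In particular the empty partition has label $(1,\dots,1)$. -}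

module Defs where

open import Data.Nat as ℕ using (ℕ; zero; suc)
open import Data.Fin as Fin using (Fin; zero; suc; toℕ; _<_; _≤_)
open import Data.Fin.Properties using (_<?_; all?)
import Data.Nat.Properties as ℕP
import Data.Fin.Properties as FinP
open import Data.Maybe using (Maybe; just; nothing)
import Data.Maybe as Maybe
open import Data.Product using (Σ; _×_; _,_)
open import Data.Sum using (_⊎_)
open import Data.Unit using (⊤; tt)
open import Data.Empty using (⊥)
open import Relation.Nullary using (¬_; Dec; yes; no)
open import Relation.Nullary.Decidable using (_×-dec_; _→-dec_; ¬?)
open import Relation.Binary using (Decidable; IsEquivalence)
open import Relation.Binary.PropositionalEquality using (_≡_)
import Relation.Unary as U

-- A set partition of [n] is given by its "same block" relation on the
-- ground set.  Elements of [n] = {1,…,n} are represented by Fin n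
-- (element i+1 ↦ i); all comparisons are order comparisons, so the
-- shift is harmless.

record DecRel (n : ℕ) : Set₁ where
  field
    R  : Fin n → Fin n → Set
    R? : Decidable R
open DecRel public

IsSetPartition : ∀ {n} → DecRel n → Set
IsSetPartition π = IsEquivalence (R π)

-- Standard representation: (i,j) is an arc iff i<j lie in the same block
-- and no element of that block lies strictly between them.
Arc : ∀ {n} → DecRel n → Fin n → Fin n → Set
Arc π i j = i < j × R π i j × (∀ k → i < k → k < j → ¬ R π i k)

-- A (k+1)-nesting: arcs (I r, J r), r = 0..k, with
-- I 0 < I 1 < … < I k < J k < … < J 0.
record Nesting {n} (π : DecRel n) (k : ℕ) : Set where
  field
    I J    : Fin (suc k) → Fin n
    arc    : ∀ r → Arc π (I r) (J r)
    I-incr : ∀ r s → r < s → I r < I s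
    J-decr : ∀ r s → r < s → J s < J r
    inner  : I (Fin.fromℕ k) < J (Fin.fromℕ k)

NonNesting : ∀ {n} → DecRel n → ℕ → Set
NonNesting π k = ¬ Nesting π k

IsMax : ∀ {n} → DecRel n → Fin n → Set
IsMax π i = ∀ j → i < j → ¬ R π i j

isMax? : ∀ {n} (π : DecRel n) → U.Decidable (IsMax π)
isMax? π i = all? (λ j → (i <? j) →-dec ¬? (R? π i j))

count : ∀ {n} {P : Fin n → Set} → U.Decidable P → ℕ
count {zero}  P? = 0
count {suc n} P? with P? zero
... | yes _ = suc (count (λ x → P? (suc x)))
... | no  _ = count (λ x → P? (suc x))

-- number of blocks (= number of block maxima; each block has exactly one)
numBlocks : ∀ {n} → DecRel n → ℕ
numBlocks π = count (isMax? π)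

maxAbove : ∀ {n} → DecRel n → Fin n → ℕ
maxAbove π v = count (λ x → isMax? π x ×-dec (v <? x))

-- i is the maximal element of block number l (blocks numbered 1,2,…
-- in decreasing order of their maxima)
BlockMax : ∀ {n} → DecRel n → ℕ → Fin n → Set
BlockMax π l i = IsMax π i × suc (maxAbove π i) ≡ l

RightmostStart : ∀ {n} → DecRel n → ℕ → Fin n → Set
RightmostStart π k v =
  Σ (Nesting π k) (λ N → Nesting.I N zero ≡ v)
  × (∀ (N : Nesting π k) → Nesting.I N zero ≤ v)

-- a = a_{k+1}(π)
LabelEntry : ∀ {n} → DecRel n → ℕ → ℕ → Set
LabelEntry {n} π k a =
  (NonNesting π k × a ≡ suc (numBlocks π))
  ⊎ Σ (Fin n) (λ v → RightmostStart π k v × a ≡ suc (maxAbove π v))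

-- L(π) = a, where a r is a_{r+1}
HasLabel : ∀ {n} → DecRel n → (m : ℕ) → (Fin m → ℕ) → Set
HasLabel π m a = ∀ (r : Fin m) → LabelEntry π (toℕ r) (a r)

-- Adding the element n+1 (represented by Fin.fromℕ n).

cut : ∀ {n} → Fin (suc n) → Maybe (Fin n)
cut {zero}  zero    = nothing
cut {suc n} zero    = just zero
cut {suc n} (suc i) = Maybe.map suc (cut i)

addSingleton : ∀ {n} → DecRel n → DecRel (suc n)
addSingleton {n} π = record { R = Rel' ; R? = dec }
  where
  Rel' : Fin (suc n) → Fin (suc n) → Set
  Rel' x y with cut x | cut y
  ... | just a  | just b  = R π a b
  ... | just _  | nothing = ⊥
  ... | nothing | just _  = ⊥
  ... | nothing | nothing = ⊤
  dec : Decidable Rel'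
  dec x y with cut x | cut y
  ... | just a  | just b  = R? π a b
  ... | just _  | nothing = no (λ ())
  ... | nothing | just _  = no (λ ())
  ... | nothing | nothing = yes tt

-- into the block of π containing i (used with i the maximum of block l)
addTo : ∀ {n} → DecRel n → Fin n → DecRel (suc n)
addTo {n} π i = record { R = Rel' ; R? = dec }
  where
  Rel' : Fin (suc n) → Fin (suc n) → Set
  Rel' x y with cut x | cut y
  ... | just a  | just b  = R π a b
  ... | just a  | nothing = R π a i
  ... | nothing | just b  = R π i b
  ... | nothing | nothing = ⊤
  dec : Decidable Rel'
  dec x y with cut x | cut y
  ... | just a  | just b  = R? π a b
  ... | just a  | nothing = R? π a i
  ... | nothing | just b  = R? π i b
  ... | nothing | nothing = yes tt

-- The label (a_1+1,…,a_{j-1}+1, x, a_{j+1},…,a_m), where position j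
-- (1-based) is the Fin index j (0-based).
updLabel : ∀ {m} → (Fin m → ℕ) → Fin m → ℕ → Fin m → ℕ
updLabel a j x r with toℕ r ℕP.<? toℕ j | r FinP.≟ j
... | yes _ | _     = suc (a r)
... | no _  | yes _ = x
... | no _  | no _  = a r

-- Let π′ arise from π by adding n+1.  A nesting of π′ either avoids n+1, and is then a nesting
-- of π, or its outer arc is the unique arc ending in n+1: there is none for a new singleton, and
-- it is (i, n+1) when n+1 joins the block with maximum i, the remaining arcs then forming a
-- nesting of π right of i.  The number of block maxima right of a vertex v grows by one for every
-- v after adding a singleton, and exactly for v ≥ i after joining the block of i.  So compare the
-- block number l of i with a label entry x: if x ≤ l the rightmost nesting lies right of i,
-- survives, and x becomes x + 1; if l < x all nestings of π start left of i, and x is kept unless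
-- the new arc creates a nesting starting at i, which makes the entry l + 1.  Labels are monotone,
-- so the entries fall into these cases in the order stated, and the new arc creates an
-- (m+1)-nesting exactly when a_m ≤ l.

module Submission where

open import Defs
open import Data.Nat using (ℕ; suc; _<_; _≤_)
open import Data.Fin using (Fin; zero; suc; toℕ; fromℕ; inject₁)
open import Data.Product using (Σ; _×_)
open import Function.Bundles using (_⇔_)

open import Data.Nat using (zero; z≤n; s≤s)
import Data.Nat.Properties as ℕₚ
import Data.Fin as Fin
import Data.Fin.Properties as Finₚ
open import Data.Fin.Properties using (_<?_)
open import Data.Product using (_,_; proj₁; proj₂)
open import Data.Sum using (_⊎_; inj₁; inj₂)
open import Data.Maybe using (just; nothing)
open import Data.Unit using (⊤; tt)
open import Data.Empty using (⊥-elim)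
open import Function using (_∘_; id)
open import Function.Bundles using (mk⇔)
open import Relation.Nullary using (¬_; Dec; yes; no; contradiction)
open import Relation.Nullary.Decidable using (_×-dec_; _⊎-dec_)
open import Relation.Binary using (IsEquivalence; tri<; tri≈; tri>)
open import Relation.Binary.PropositionalEquality hiding (J)
open import Relation.Unary using (Decidable; _⊆_)

variable
  k n q : ℕ

count-mono : {P Q : Fin n → Set} (P? : Decidable P) (Q? : Decidable Q) →
             P ⊆ Q → count P? ≤ count Q?
count-mono {n = zero}  P? Q? P⊆Q = z≤n
count-mono {n = suc n} P? Q? P⊆Q with P? zero | Q? zero
... | yes _ | yes _  = s≤s (count-mono (P? ∘ suc) (Q? ∘ suc) P⊆Q)
... | yes p | no ¬q  = contradiction (P⊆Q p) ¬q
... | no _  | yes _  = ℕₚ.m≤n⇒m≤1+n (count-mono (P? ∘ suc) (Q? ∘ suc) P⊆Q)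
... | no _  | no _   = count-mono (P? ∘ suc) (Q? ∘ suc) P⊆Q

count-cong : {P Q : Fin n → Set} (P? : Decidable P) (Q? : Decidable Q) →
             P ⊆ Q → Q ⊆ P → count P? ≡ count Q?
count-cong P? Q? P⊆Q Q⊆P = ℕₚ.≤-antisym (count-mono P? Q? P⊆Q) (count-mono Q? P? Q⊆P)

count-insert : {P Q : Fin n → Set} (P? : Decidable P) (Q? : Decidable Q) {i : Fin n} →
               Q i → ¬ P i → P ⊆ Q → (∀ {x} → Q x → x ≢ i → P x) →
               count Q? ≡ suc (count P?)
count-insert {n = suc n} P? Q? {zero} qi ¬pi P⊆Q Q⊆P+i with P? zero | Q? zero
... | yes p | _     = contradiction p ¬pi
... | no _  | no ¬q = contradiction qi ¬q
... | no _  | yes _ = cong suc (count-cong (Q? ∘ suc) (P? ∘ suc) (λ q → Q⊆P+i q λ ()) P⊆Q)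
count-insert {n = suc n} P? Q? {suc i} qi ¬pi P⊆Q Q⊆P+i with P? zero | Q? zero
... | yes _ | yes _ = cong suc (count-insert (P? ∘ suc) (Q? ∘ suc) qi ¬pi P⊆Q
                                 λ q x≢i → Q⊆P+i q (x≢i ∘ Finₚ.suc-injective))
... | yes p | no ¬q = contradiction (P⊆Q p) ¬q
... | no ¬p | yes q = contradiction (Q⊆P+i q λ ()) ¬p
... | no _  | no _  = count-insert (P? ∘ suc) (Q? ∘ suc) qi ¬pi P⊆Q
                        λ q x≢i → Q⊆P+i q (x≢i ∘ Finₚ.suc-injective)

count-mono-< : {P Q : Fin n → Set} (P? : Decidable P) (Q? : Decidable Q) {i : Fin n} →
               P ⊆ Q → Q i → ¬ P i → count P? < count Q?
count-mono-< {P = P} P? Q? {i} P⊆Q qi ¬pi =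
  subst (_≤ count Q?) (count-insert P? P+i? (inj₂ refl) ¬pi inj₁ P+i⊆P)
        (count-mono P+i? Q? λ { (inj₁ p) → P⊆Q p ; (inj₂ refl) → qi })
  where
  P+i? = λ x → P? x ⊎-dec (x Finₚ.≟ i)
  P+i⊆P : ∀ {x} → P x ⊎ x ≡ i → x ≢ i → P x
  P+i⊆P (inj₁ p) _   = p
  P+i⊆P (inj₂ e) x≢i = contradiction e x≢i

count-last : {P : Fin (suc n) → Set} (P? : Decidable P) →
             P (fromℕ n) → count P? ≡ suc (count (P? ∘ inject₁))
count-last {n = zero} P? p with P? zero
... | yes _ = refl
... | no ¬p = contradiction p ¬p
count-last {n = suc n} P? p with P? zero
... | yes _ = cong suc (count-last (P? ∘ suc) p)
... | no _  = count-last (P? ∘ suc) p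

count-suc-yes : {P : Fin (suc n) → Set} (P? : Decidable P) →
                P zero → count P? ≡ suc (count (P? ∘ suc))
count-suc-yes P? p with P? zero
... | yes _  = refl
... | no ¬p = contradiction p ¬p

count-suc-no : {P : Fin (suc n) → Set} (P? : Decidable P) →
               ¬ P zero → count P? ≡ count (P? ∘ suc)
count-suc-no P? ¬p with P? zero
... | yes p = contradiction p ¬p
... | no _  = refl

element-of-rank : {P : Fin n → Set} (P? : Decidable P) (c : ℕ) → c < count P? →
                  Σ (Fin n) λ x → P x × count (λ z → P? z ×-dec (x <? z)) ≡ c
element-of-rank {n = suc n} {P} P? c c<count = by-cases (P? zero)
  where
  Rank : Fin (suc n) → Set
  Rank x = P x × count (λ z → P? z ×-dec (x <? z)) ≡ c

  count-above-suc : ∀ y → count (λ z → P? z ×-dec (suc y <? z)) ≡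
                          count (λ z → P? (suc z) ×-dec (y <? z))
  count-above-suc y =
    trans (count-suc-no (λ z → P? z ×-dec (suc y <? z)) λ { (_ , ()) })
          (count-cong (λ z → P? (suc z) ×-dec (suc y <? suc z)) (λ z → P? (suc z) ×-dec (y <? z))
                      (λ { (p , s≤s y<z) → p , y<z }) (λ (p , y<z) → p , s≤s y<z))

  shift : c < count (P? ∘ suc) → Σ (Fin (suc n)) Rank
  shift c<count′ with element-of-rank (P? ∘ suc) c c<count′
  ... | y , py , rank = suc y , py , trans (count-above-suc y) rank

  by-cases : Dec (P zero) → Σ (Fin (suc n)) Rank
  by-cases (no ¬p) = shift (subst (c <_) (count-suc-no P? ¬p) c<count)
  by-cases (yes p) with c ℕₚ.≟ count (P? ∘ suc)
  -- Fin's _<?_ compares elements of possibly different Fin types, so the size of zero is given.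
  ... | yes refl = zero , p ,
    trans (count-suc-no (λ z → P? z ×-dec (zero {n = n} <? z)) λ { (_ , ()) })
          (count-cong (λ z → P? (suc z) ×-dec (zero {n = n} <? suc z)) (P? ∘ suc)
                      proj₁ (λ p′ → p′ , s≤s z≤n))
  ... | no c≢ =
    shift (ℕₚ.≤∧≢⇒< (ℕₚ.≤-pred (subst (c <_) (count-suc-yes P? p) c<count)) c≢)

inject₁-< : {a b : Fin n} → a Fin.< b → inject₁ a Fin.< inject₁ b
inject₁-< {a = a} {b} = subst₂ _<_ (sym (Finₚ.toℕ-inject₁ a)) (sym (Finₚ.toℕ-inject₁ b))

inject₁-<⁻¹ : {a b : Fin n} → inject₁ a Fin.< inject₁ b → a Fin.< b
inject₁-<⁻¹ {a = a} {b} = subst₂ _<_ (Finₚ.toℕ-inject₁ a) (Finₚ.toℕ-inject₁ b)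

inject₁-≤ : {a b : Fin n} → a Fin.≤ b → inject₁ a Fin.≤ inject₁ b
inject₁-≤ {a = a} {b} = subst₂ _≤_ (sym (Finₚ.toℕ-inject₁ a)) (sym (Finₚ.toℕ-inject₁ b))

inject₁<fromℕ : (a : Fin n) → inject₁ a Fin.< fromℕ n
inject₁<fromℕ {n} a = subst (toℕ (inject₁ a) <_) (sym (Finₚ.toℕ-fromℕ n)) (Finₚ.inject₁ℕ< a)

fromℕ≮ : (x : Fin (suc n)) → ¬ fromℕ n Fin.< x
fromℕ≮ x = ℕₚ.≤⇒≯ (Finₚ.≤fromℕ x)

<fromℕ⊎≡fromℕ : (x : Fin (suc n)) → x Fin.< fromℕ n ⊎ x ≡ fromℕ n
<fromℕ⊎≡fromℕ x with ℕₚ.m≤n⇒m<n∨m≡n (Finₚ.≤fromℕ x)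
... | inj₁ x<last = inj₁ x<last
... | inj₂ x≡last = inj₂ (Finₚ.toℕ-injective x≡last)

lower : (x : Fin (suc n)) → x Fin.< fromℕ n → Fin n
lower {n} x x<last = Fin.lower₁ x (ℕₚ.>⇒≢ (subst (toℕ x <_) (Finₚ.toℕ-fromℕ n) x<last))

inject₁-lower : (x : Fin (suc n)) (x<last : x Fin.< fromℕ n) → inject₁ (lower x x<last) ≡ x
inject₁-lower x _ = Finₚ.inject₁-lower₁ x _

lower-< : {x y : Fin (suc n)} (x<last : x Fin.< fromℕ n) (y<last : y Fin.< fromℕ n) →
          x Fin.< y → lower x x<last Fin.< lower y y<last
lower-< {x = x} {y} x<last y<last x<y =
  inject₁-<⁻¹ (subst₂ Fin._<_ (sym (inject₁-lower x x<last)) (sym (inject₁-lower y y<last)) x<y)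

cut-inject₁ : (a : Fin n) → cut (inject₁ a) ≡ just a
cut-inject₁ {suc n} zero = refl
cut-inject₁ {suc n} (suc a) rewrite cut-inject₁ a = refl

cut-fromℕ : ∀ n → cut (fromℕ n) ≡ nothing
cut-fromℕ zero = refl
cut-fromℕ (suc n) rewrite cut-fromℕ n = refl

fromℕ-IsMax : (π : DecRel (suc n)) → IsMax π (fromℕ n)
fromℕ-IsMax π x last<x _ = fromℕ≮ x last<x

arc⇒¬IsMax : {π : DecRel n} {v w : Fin n} → Arc π v w → ¬ IsMax π v
arc⇒¬IsMax (v<w , vRw , _) v-max = v-max _ v<w vRw

IsMax-unique : {π : DecRel n} → IsSetPartition π → {x y : Fin n} →
               IsMax π x → IsMax π y → R π x y → x ≡ y
IsMax-unique isPartition {x} {y} x-max y-max xRy with Finₚ.<-cmp x y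
... | tri< x<y _ _ = contradiction xRy (x-max y x<y)
... | tri≈ _ x≡y _ = x≡y
... | tri> _ _ y<x = contradiction (IsEquivalence.sym isPartition xRy) (y-max x y<x)

isMaxAbove? : (π : DecRel n) (v : Fin n) → Decidable (λ x → IsMax π x × v Fin.< x)
isMaxAbove? π v x = isMax? π x ×-dec (v <? x)

maxAbove≤numBlocks : (π : DecRel n) (v : Fin n) → maxAbove π v ≤ numBlocks π
maxAbove≤numBlocks π v = count-mono (isMaxAbove? π v) (isMax? π) proj₁

maxAbove<numBlocks : {π : DecRel n} {i : Fin n} → IsMax π i → maxAbove π i < numBlocks π
maxAbove<numBlocks {π = π} {i} i-max =
  count-mono-< (isMaxAbove? π i) (isMax? π) proj₁ i-max (ℕₚ.<-irrefl refl ∘ proj₂)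

maxAbove-antitone : (π : DecRel n) {v w : Fin n} → v Fin.≤ w → maxAbove π w ≤ maxAbove π v
maxAbove-antitone π {v} {w} v≤w =
  count-mono (isMaxAbove? π w) (isMaxAbove? π v) λ (x-max , w<x) → x-max , ℕₚ.≤-<-trans v≤w w<x

maxAbove-strict : {π : DecRel n} {v i : Fin n} → v Fin.< i → IsMax π i →
                  maxAbove π i < maxAbove π v
maxAbove-strict {π = π} {v} {i} v<i i-max =
  count-mono-< (isMaxAbove? π i) (isMaxAbove? π v)
    (λ (x-max , i<x) → x-max , ℕₚ.<-trans v<i i<x) (i-max , v<i) (ℕₚ.<-irrefl refl ∘ proj₂)

dropOuter : {π : DecRel n} → Nesting π (suc q) → Nesting π q
dropOuter N = record
  { I      = I ∘ suc
  ; J      = J ∘ suc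
  ; arc    = arc ∘ suc
  ; I-incr = λ r s r<s → I-incr (suc r) (suc s) (s≤s r<s)
  ; J-decr = λ r s r<s → J-decr (suc r) (suc s) (s≤s r<s)
  ; inner  = inner
  }
  where open Nesting N

start≤ : {π : DecRel n} (N : Nesting π q) → ∀ r → Nesting.I N zero Fin.≤ Nesting.I N r
start≤ N zero    = ℕₚ.≤-refl
start≤ N (suc r) = ℕₚ.<⇒≤ (Nesting.I-incr N zero (suc r) (s≤s z≤n))

end≤ : {π : DecRel n} (N : Nesting π q) → ∀ r → Nesting.J N r Fin.≤ Nesting.J N zero
end≤ N zero    = ℕₚ.≤-refl
end≤ N (suc r) = ℕₚ.<⇒≤ (Nesting.J-decr N zero (suc r) (s≤s z≤n))

outerArc : {π : DecRel n} {x y : Fin n} → Arc π x y → (N : Nesting π q) →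
           x Fin.< Nesting.I N zero → Nesting.J N zero Fin.< y → Nesting π (suc q)
outerArc {q = q} {π = π} {x} {y} xy N x<I₀ J₀<y = record
  { I = I′ ; J = J′ ; arc = arc′ ; I-incr = I′-incr ; J-decr = J′-decr ; inner = inner }
  where
  open Nesting N
  I′ J′ : Fin (suc (suc q)) → Fin _
  I′ zero    = x
  I′ (suc r) = I r
  J′ zero    = y
  J′ (suc r) = J r
  arc′ : ∀ r → Arc π (I′ r) (J′ r)
  arc′ zero    = xy
  arc′ (suc r) = arc r
  I′-incr : ∀ r s → r Fin.< s → I′ r Fin.< I′ s
  I′-incr zero    (suc s) _         = ℕₚ.<-≤-trans x<I₀ (start≤ N s)
  I′-incr (suc r) (suc s) (s≤s r<s) = I-incr r s r<s
  J′-decr : ∀ r s → r Fin.< s → J′ s Fin.< J′ r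
  J′-decr zero    (suc s) _         = ℕₚ.≤-<-trans (end≤ N s) J₀<y
  J′-decr (suc r) (suc s) (s≤s r<s) = J-decr r s r<s

LabelEntry≤ : {π : DecRel n} {x : ℕ} → LabelEntry π q x → x ≤ suc (numBlocks π)
LabelEntry≤ (inj₁ (_ , refl))              = ℕₚ.≤-refl
LabelEntry≤ {π = π} (inj₂ (v , _ , refl)) = s≤s (maxAbove≤numBlocks π v)

-- Dropping the outer arc of a (q+2)-nesting leaves a (q+1)-nesting starting further right.
LabelEntry-step : {π : DecRel n} {x y : ℕ} → LabelEntry π q x → LabelEntry π (suc q) y → x ≤ y
LabelEntry-step (inj₁ (_ , refl)) (inj₁ (_ , refl)) = ℕₚ.≤-refl
LabelEntry-step {π = π} (inj₂ (v , _ , refl)) (inj₁ (_ , refl)) = s≤s (maxAbove≤numBlocks π v)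
LabelEntry-step (inj₁ (nonNesting , _)) (inj₂ (_ , ((N , _) , _) , _)) =
  contradiction (dropOuter N) nonNesting
LabelEntry-step {π = π} (inj₂ (v , (_ , v-rightmost) , refl)) (inj₂ (w , ((N , refl) , _) , refl)) =
  s≤s (maxAbove-antitone π (ℕₚ.<⇒≤ (ℕₚ.<-≤-trans (Nesting.I-incr N zero (suc zero) (s≤s z≤n))
                                                 (v-rightmost (dropOuter N)))))

rightmostStart-¬IsMax : {π : DecRel n} {v : Fin n} → RightmostStart π q v → ¬ IsMax π v
rightmostStart-¬IsMax {π = π} ((N , refl) , _) = arc⇒¬IsMax {π = π} (Nesting.arc N zero)

module _ {π : DecRel n} {i : Fin n} (i-max : IsMax π i) where

  nestings-start-before : {x : ℕ} → LabelEntry π q x → suc (maxAbove π i) < x →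
                          (N : Nesting π q) → Nesting.I N zero Fin.< i
  nestings-start-before (inj₁ (nonNesting , _)) _ N = contradiction N nonNesting
  nestings-start-before (inj₂ (v , v-rightmost , refl)) l<x N with Finₚ.<-cmp v i
  ... | tri< v<i _ _  = ℕₚ.≤-<-trans (proj₂ v-rightmost N) v<i
  ... | tri≈ _ refl _ = contradiction i-max (rightmostStart-¬IsMax {π = π} v-rightmost)
  ... | tri> _ _ i<v  = contradiction l<x (ℕₚ.≤⇒≯ (s≤s (maxAbove-antitone π (ℕₚ.<⇒≤ i<v))))

  rightmostStart-after : {x : ℕ} → LabelEntry π q x → x ≤ suc (maxAbove π i) →
                         Σ (Fin n) λ v → RightmostStart π q v × i Fin.< v × x ≡ suc (maxAbove π v)
  rightmostStart-after (inj₁ (_ , refl)) x≤l =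
    contradiction (maxAbove<numBlocks {π = π} i-max) (ℕₚ.≤⇒≯ (ℕₚ.≤-pred x≤l))
  rightmostStart-after (inj₂ (v , v-rightmost , refl)) x≤l with Finₚ.<-cmp v i
  ... | tri< v<i _ _  =
    contradiction (maxAbove-strict {π = π} v<i i-max) (ℕₚ.≤⇒≯ (ℕₚ.≤-pred x≤l))
  ... | tri≈ _ refl _ = contradiction i-max (rightmostStart-¬IsMax {π = π} v-rightmost)
  ... | tri> _ _ i<v  = v , v-rightmost , i<v , refl

data LastView : Fin (suc n) → Set where
  old : (a : Fin n) → LastView (inject₁ a)
  new : LastView (fromℕ n)

lastView : (x : Fin (suc n)) → LastView x
lastView {zero}  zero    = new
lastView {suc n} zero    = old zero
lastView {suc n} (suc x) with lastView x
... | old a = old (suc a)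
... | new   = new

module OnePointExtension (π : DecRel n) (π′ : DecRel (suc n))
  (R-inject₁ : ∀ a b → R π′ (inject₁ a) (inject₁ b) ≡ R π a b) where

  R↓ : ∀ {a b} → R π′ (inject₁ a) (inject₁ b) → R π a b
  R↓ {a} {b} = subst id (R-inject₁ a b)

  R↑ : ∀ {a b} → R π a b → R π′ (inject₁ a) (inject₁ b)
  R↑ {a} {b} = subst id (sym (R-inject₁ a b))

  arc↑ : ∀ {a b} → Arc π a b → Arc π′ (inject₁ a) (inject₁ b)
  arc↑ {a} {b} (a<b , aRb , gap) = inject₁-< a<b , R↑ aRb , gap′
    where
    gap′ : ∀ x → inject₁ a Fin.< x → x Fin.< inject₁ b → ¬ R π′ (inject₁ a) x
    gap′ x a<x x<b with lastView x
    ... | old c = gap c (inject₁-<⁻¹ a<x) (inject₁-<⁻¹ x<b) ∘ R↓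
    ... | new   = contradiction x<b (fromℕ≮ (inject₁ b))

  arc↓ : ∀ {a b} → Arc π′ (inject₁ a) (inject₁ b) → Arc π a b
  arc↓ (a<b , aRb , gap) =
    inject₁-<⁻¹ a<b , R↓ aRb ,
    λ c a<c c<b → gap (inject₁ c) (inject₁-< a<c) (inject₁-< c<b) ∘ R↑

  nesting↑ : Nesting π q → Nesting π′ q
  nesting↑ N = record
    { I      = inject₁ ∘ I
    ; J      = inject₁ ∘ J
    ; arc    = arc↑ ∘ arc
    ; I-incr = λ r s r<s → inject₁-< (I-incr r s r<s)
    ; J-decr = λ r s r<s → inject₁-< (J-decr r s r<s)
    ; inner  = inject₁-< inner
    }
    where open Nesting N

  nesting↓ : (N : Nesting π′ q) → Nesting.J N zero Fin.< fromℕ n →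
             Σ (Nesting π q) λ M → inject₁ (Nesting.I M zero) ≡ Nesting.I N zero
  nesting↓ {q} N J₀<last = M , inject₁-lower (I zero) (I<last zero)
    where
    open Nesting N
    J<last : ∀ r → J r Fin.< fromℕ n
    J<last r = ℕₚ.≤-<-trans (end≤ N r) J₀<last
    I<last : ∀ r → I r Fin.< fromℕ n
    I<last r = ℕₚ.<-trans (proj₁ (arc r)) (J<last r)
    I↓ J↓ : Fin (suc q) → Fin n
    I↓ r = lower (I r) (I<last r)
    J↓ r = lower (J r) (J<last r)
    M : Nesting π q
    M = record
      { I      = I↓
      ; J      = J↓
      ; arc    = λ r → arc↓ (subst₂ (Arc π′) (sym (inject₁-lower (I r) (I<last r)))
                                             (sym (inject₁-lower (J r) (J<last r))) (arc r))
      ; I-incr = λ r s r<s → lower-< (I<last r) (I<last s) (I-incr r s r<s)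
      ; J-decr = λ r s r<s → lower-< (J<last s) (J<last r) (J-decr r s r<s)
      ; inner  = lower-< (I<last _) (J<last _) inner
      }

  data NestingView (N : Nesting π′ q) : Set where
    old : (M : Nesting π q) → inject₁ (Nesting.I M zero) ≡ Nesting.I N zero → NestingView N
    new : (a : Fin n) → inject₁ a ≡ Nesting.I N zero → Arc π′ (inject₁ a) (fromℕ n) →
          Nesting.J N zero ≡ fromℕ n → NestingView N

  nestingView : (N : Nesting π′ q) → NestingView N
  nestingView N with <fromℕ⊎≡fromℕ (Nesting.J N zero)
  ... | inj₁ J₀<last = let M , e = nesting↓ N J₀<last in old M e
  ... | inj₂ J₀≡last = new (lower I₀ I₀<last) I₀↓ (subst₂ (Arc π′) (sym I₀↓) J₀≡last (Nesting.arc N zero))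
                          J₀≡last
    where
    I₀ = Nesting.I N zero
    I₀<last : I₀ Fin.< fromℕ n
    I₀<last = subst (I₀ Fin.<_) J₀≡last (proj₁ (Nesting.arc N zero))
    I₀↓ = inject₁-lower I₀ I₀<last

  isMax↑ : ∀ {x} → IsMax π x → ¬ R π′ (inject₁ x) (fromℕ n) → IsMax π′ (inject₁ x)
  isMax↑ {x} x-max ¬xRlast y x<y with lastView y
  ... | old c = x-max c (inject₁-<⁻¹ x<y) ∘ R↓
  ... | new   = ¬xRlast

  isMax↓ : ∀ {x} → IsMax π′ (inject₁ x) → IsMax π x × ¬ R π′ (inject₁ x) (fromℕ n)
  isMax↓ {x} x-max = (λ y x<y → x-max (inject₁ y) (inject₁-< x<y) ∘ R↑)
                   , x-max (fromℕ n) (inject₁<fromℕ x)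

  numBlocks-extension : numBlocks π′ ≡ suc (count (isMax? π′ ∘ inject₁))
  numBlocks-extension = count-last (isMax? π′) (fromℕ-IsMax π′)

  oldMaxAbove? : (v : Fin n) → Decidable (λ x → IsMax π′ (inject₁ x) × v Fin.< x)
  oldMaxAbove? v x = isMax? π′ (inject₁ x) ×-dec (v <? x)

  maxAbove-extension : ∀ v → maxAbove π′ (inject₁ v) ≡ suc (count (oldMaxAbove? v))
  maxAbove-extension v =
    trans (count-last (isMaxAbove? π′ (inject₁ v)) (fromℕ-IsMax π′ , inject₁<fromℕ v))
          (cong suc (count-cong (isMaxAbove? π′ (inject₁ v) ∘ inject₁) (oldMaxAbove? v)
                                (λ (m , v<x) → m , inject₁-<⁻¹ v<x) (λ (m , v<x) → m , inject₁-< v<x)))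

module AddSingleton (π : DecRel n) where

  R-inject₁ : ∀ a b → R (addSingleton π) (inject₁ a) (inject₁ b) ≡ R π a b
  R-inject₁ a b rewrite cut-inject₁ a | cut-inject₁ b = refl

  ¬R-fromℕ : ∀ a → ¬ R (addSingleton π) (inject₁ a) (fromℕ n)
  ¬R-fromℕ a rewrite cut-inject₁ a | cut-fromℕ n = λ ()

  open OnePointExtension π (addSingleton π) R-inject₁

  nesting-restricts : (N : Nesting (addSingleton π) q) →
                      Σ (Nesting π q) λ M → inject₁ (Nesting.I M zero) ≡ Nesting.I N zero
  nesting-restricts N with nestingView N
  ... | old M e                  = M , e
  ... | new a _ (_ , aRlast , _) _ = contradiction aRlast (¬R-fromℕ a)

  nonNesting : NonNesting π q → NonNesting (addSingleton π) q
  nonNesting ¬N = ¬N ∘ proj₁ ∘ nesting-restricts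

  numBlocks-addSingleton : numBlocks (addSingleton π) ≡ suc (numBlocks π)
  numBlocks-addSingleton = trans numBlocks-extension
    (cong suc (count-cong (isMax? (addSingleton π) ∘ inject₁) (isMax? π)
                          (proj₁ ∘ isMax↓) (λ m → isMax↑ m (¬R-fromℕ _))))

  maxAbove-addSingleton : ∀ v → maxAbove (addSingleton π) (inject₁ v) ≡ suc (maxAbove π v)
  maxAbove-addSingleton v = trans (maxAbove-extension v)
    (cong suc (count-cong (oldMaxAbove? v) (isMaxAbove? π v)
                          (λ (m , v<x) → proj₁ (isMax↓ m) , v<x)
                          (λ (m , v<x) → isMax↑ m (¬R-fromℕ _) , v<x)))

  labelEntry : {x : ℕ} → LabelEntry π q x → LabelEntry (addSingleton π) q (suc x)
  labelEntry (inj₁ (¬N , refl)) = inj₁ (nonNesting ¬N , cong suc (sym numBlocks-addSingleton))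
  labelEntry {q} (inj₂ (v , ((N , N≡v) , v-rightmost) , refl)) =
    inj₂ ( inject₁ v , ((nesting↑ N , cong inject₁ N≡v) , upper)
         , cong suc (sym (maxAbove-addSingleton v)))
    where
    upper : ∀ (N′ : Nesting (addSingleton π) q) → Nesting.I N′ zero Fin.≤ inject₁ v
    upper N′ = let M , e = nesting-restricts N′ in
               subst (Fin._≤ inject₁ v) e (inject₁-≤ (v-rightmost M))

module _ {m : ℕ} (a : Fin m → ℕ) (j : Fin m) (x : ℕ) where

  updLabel-< : ∀ {r} → r Fin.< j → updLabel a j x r ≡ suc (a r)
  updLabel-< {r} r<j with toℕ r ℕₚ.<? toℕ j
  ... | yes _   = refl
  ... | no r≮j = contradiction r<j r≮j

  updLabel-≡ : updLabel a j x j ≡ x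
  updLabel-≡ with toℕ j ℕₚ.<? toℕ j | j Finₚ.≟ j
  ... | yes j<j | _      = contradiction j<j (ℕₚ.<-irrefl refl)
  ... | no _    | yes _  = refl
  ... | no _    | no j≢j = contradiction refl j≢j

  updLabel-> : ∀ {r} → j Fin.< r → updLabel a j x r ≡ a r
  updLabel-> {r} j<r with toℕ r ℕₚ.<? toℕ j | r Finₚ.≟ j
  ... | yes r<j  | _      = contradiction r<j (ℕₚ.<-asym j<r)
  ... | no _     | yes refl = contradiction j<r (ℕₚ.<-irrefl refl)
  ... | no _     | no _   = refl

adjacent⇒mono : (a : Fin (suc k) → ℕ) → (∀ s → a (inject₁ s) ≤ a (suc s)) →
                ∀ {r s} → r Fin.≤ s → a r ≤ a s
adjacent⇒mono           a adj {zero}  {zero}  _         = ℕₚ.≤-refl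
adjacent⇒mono {k = suc k} a adj {zero}  {suc s} _         =
  ℕₚ.≤-trans (adj zero) (adjacent⇒mono (a ∘ suc) (adj ∘ suc) {zero} {s} z≤n)
adjacent⇒mono {k = suc k} a adj {suc r} {suc s} (s≤s r≤s) = adjacent⇒mono (a ∘ suc) (adj ∘ suc) r≤s

module _ {π : DecRel n} {a : Fin (suc k) → ℕ} (hl : HasLabel π (suc k) a) where

  HasLabel-inject₁ : (r : Fin k) → LabelEntry π (toℕ r) (a (inject₁ r))
  HasLabel-inject₁ r =
    subst (λ q → LabelEntry π q (a (inject₁ r))) (Finₚ.toℕ-inject₁ r) (hl (inject₁ r))

  HasLabel-fromℕ : LabelEntry π k (a (fromℕ k))
  HasLabel-fromℕ = subst (λ q → LabelEntry π q (a (fromℕ k))) (Finₚ.toℕ-fromℕ k) (hl (fromℕ k))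

  HasLabel-mono : ∀ {r s} → r Fin.≤ s → a r ≤ a s
  HasLabel-mono = adjacent⇒mono a λ s → LabelEntry-step (HasLabel-inject₁ s) (hl (suc s))

module AddTo {π : DecRel n} (isPartition : IsSetPartition π) {i : Fin n} (i-max : IsMax π i) where

  π′ : DecRel (suc n)
  π′ = addTo π i

  l : ℕ
  l = suc (maxAbove π i)

  R-inject₁ : ∀ a b → R π′ (inject₁ a) (inject₁ b) ≡ R π a b
  R-inject₁ a b rewrite cut-inject₁ a | cut-inject₁ b = refl

  R-fromℕ : ∀ a → R π′ (inject₁ a) (fromℕ n) ≡ R π a i
  R-fromℕ a rewrite cut-inject₁ a | cut-fromℕ n = refl

  open OnePointExtension π π′ R-inject₁
  open IsEquivalence isPartition using () renaming (refl to R-refl; sym to R-sym)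

  newArc : Arc π′ (inject₁ i) (fromℕ n)
  newArc = inject₁<fromℕ i , subst id (sym (R-fromℕ i)) R-refl , gap
    where
    gap : ∀ x → inject₁ i Fin.< x → x Fin.< fromℕ n → ¬ R π′ (inject₁ i) x
    gap x i<x x<last with lastView x
    ... | old c = i-max c (inject₁-<⁻¹ i<x) ∘ R↓
    ... | new   = contradiction x<last (ℕₚ.<-irrefl refl)

  newArc-unique : ∀ {a} → Arc π′ (inject₁ a) (fromℕ n) → a ≡ i
  newArc-unique {a} (_ , aRlast , gap) with Finₚ.<-cmp a i | subst id (R-fromℕ a) aRlast
  ... | tri< a<i _ _ | aRi = contradiction (R↑ aRi) (gap (inject₁ i) (inject₁-< a<i) (inject₁<fromℕ i))
  ... | tri≈ _ a≡i _ | _   = a≡i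
  ... | tri> _ _ i<a | aRi = contradiction (R-sym aRi) (i-max a i<a)

  ¬R-fromℕ : ∀ {x} → IsMax π x → x ≢ i → ¬ R π′ (inject₁ x) (fromℕ n)
  ¬R-fromℕ {x} x-max x≢i = x≢i ∘ IsMax-unique {π = π} isPartition x-max i-max ∘ subst id (R-fromℕ x)

  i-notMax : ¬ IsMax π′ (inject₁ i)
  i-notMax i-max′ = proj₂ (isMax↓ i-max′) (proj₁ (proj₂ newArc))

  numBlocks-addTo : numBlocks π′ ≡ numBlocks π
  numBlocks-addTo = trans numBlocks-extension
    (sym (count-insert (isMax? π′ ∘ inject₁) (isMax? π) i-max i-notMax
                       (proj₁ ∘ isMax↓) (λ m x≢i → isMax↑ m (¬R-fromℕ m x≢i))))

  maxAbove-addTo-< : ∀ {v} → v Fin.< i → maxAbove π′ (inject₁ v) ≡ maxAbove π v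
  maxAbove-addTo-< {v} v<i = trans (maxAbove-extension v)
    (sym (count-insert (oldMaxAbove? v) (isMaxAbove? π v)
                       (i-max , v<i) (i-notMax ∘ proj₁)
                       (λ (m , v<x) → proj₁ (isMax↓ m) , v<x)
                       (λ (m , v<x) x≢i → isMax↑ m (¬R-fromℕ m x≢i) , v<x)))

  maxAbove-addTo-≥ : ∀ {v} → i Fin.≤ v → maxAbove π′ (inject₁ v) ≡ suc (maxAbove π v)
  maxAbove-addTo-≥ {v} i≤v = trans (maxAbove-extension v)
    (cong suc (count-cong (oldMaxAbove? v) (isMaxAbove? π v)
                          (λ (m , v<x) → proj₁ (isMax↓ m) , v<x)
                          (λ (m , v<x) → isMax↑ m (¬R-fromℕ m (λ { refl → ℕₚ.≤⇒≯ i≤v v<x })) , v<x)))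

  -- A Nesting π′ q with outer arc (i, n+1) is that arc around a Nesting π (q ∸ 1) lying right of i.
  NewNestings : ℕ → Set
  NewNestings zero    = ⊤
  NewNestings (suc q) = Σ (Nesting π q) λ N → i Fin.< Nesting.I N zero

  nestingThroughNewArc : NewNestings q → Σ (Nesting π′ q) λ N → Nesting.I N zero ≡ inject₁ i
  nestingThroughNewArc {zero} _ = record
    { I = λ _ → inject₁ i ; J = λ _ → fromℕ n ; arc = λ _ → newArc
    ; I-incr = λ { zero zero () } ; J-decr = λ { zero zero () } ; inner = inject₁<fromℕ i } , refl
  nestingThroughNewArc {suc q} (N , i<I₀) =
    outerArc newArc (nesting↑ N) (inject₁-< i<I₀) (inject₁<fromℕ _) , refl

  dropNewArc : (N : Nesting π′ q) → Nesting.I N zero ≡ inject₁ i → Nesting.J N zero ≡ fromℕ n →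
               NewNestings q
  dropNewArc {zero}  _ _    _      = tt
  dropNewArc {suc q} N I₀≡i J₀≡last = M , inject₁-<⁻¹ (subst₂ Fin._<_ I₀≡i (sym e) I₀<I₁)
    where
    open Nesting N
    I₀<I₁ = I-incr zero (suc zero) (s≤s z≤n)
    J₁<last = subst (J (suc zero) Fin.<_) J₀≡last (J-decr zero (suc zero) (s≤s z≤n))
    M = proj₁ (nesting↓ (dropOuter N) J₁<last)
    e = proj₂ (nesting↓ (dropOuter N) J₁<last)

  data AddToView (N : Nesting π′ q) : Set where
    old : (M : Nesting π q) → inject₁ (Nesting.I M zero) ≡ Nesting.I N zero → AddToView N
    new : Nesting.I N zero ≡ inject₁ i → NewNestings q → AddToView N

  addToView : (N : Nesting π′ q) → AddToView N
  addToView N with nestingView N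
  ... | old M e = old M e
  ... | new a a≡I₀ arc-a J₀≡last with newArc-unique arc-a
  ...   | refl = new (sym a≡I₀) (dropNewArc N (sym a≡I₀) J₀≡last)

  start-bound : ∀ {v} → (∀ (M : Nesting π q) → Nesting.I M zero Fin.≤ v) →
                (NewNestings q → i Fin.≤ v) →
                ∀ (N : Nesting π′ q) → Nesting.I N zero Fin.≤ inject₁ v
  start-bound {v = v} old-bound new-bound N with addToView N
  ... | old M e    = subst (Fin._≤ inject₁ v) e (inject₁-≤ (old-bound M))
  ... | new I₀≡i ν = subst (Fin._≤ inject₁ v) (sym I₀≡i) (inject₁-≤ (new-bound ν))

  nonNesting : NonNesting π q → ¬ NewNestings q → NonNesting π′ q
  nonNesting ¬N ¬new N with addToView N
  ... | old M _ = ¬N M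
  ... | new _ ν = ¬new ν

  newNestings-≤ : ∀ {y} → LabelEntry π q y → y ≤ l → NewNestings (suc q)
  newNestings-≤ entry y≤l with rightmostStart-after i-max entry y≤l
  ... | _ , ((N , refl) , _) , i<I₀ , _ = N , i<I₀

  ¬newNestings-> : ∀ {y} → LabelEntry π q y → l < y → ¬ NewNestings (suc q)
  ¬newNestings-> entry l<y (N , i<I₀) = ℕₚ.<-asym (nestings-start-before i-max entry l<y N) i<I₀

  labelEntry-≤ : ∀ {x} → LabelEntry π q x → x ≤ l → LabelEntry π′ q (suc x)
  labelEntry-≤ entry x≤l with rightmostStart-after i-max entry x≤l
  ... | v , ((N , N≡v) , v-rightmost) , i<v , refl =
    inj₂ ( inject₁ v , ((nesting↑ N , cong inject₁ N≡v) , start-bound v-rightmost (λ _ → ℕₚ.<⇒≤ i<v))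
         , cong suc (sym (maxAbove-addTo-≥ (ℕₚ.<⇒≤ i<v))))

  labelEntry-> : ∀ {x} → LabelEntry π q x → l < x → ¬ NewNestings q → LabelEntry π′ q x
  labelEntry-> (inj₁ (¬N , refl)) _ ¬new = inj₁ (nonNesting ¬N ¬new , cong suc (sym numBlocks-addTo))
  labelEntry-> entry@(inj₂ (v , ((N , N≡v) , v-rightmost) , refl)) l<x ¬new =
    inj₂ ( inject₁ v , ((nesting↑ N , cong inject₁ N≡v) , start-bound v-rightmost (⊥-elim ∘ ¬new))
         , cong suc (sym (maxAbove-addTo-< v<i)))
    where v<i = subst (Fin._< i) N≡v (nestings-start-before i-max entry l<x N)

  labelEntry-new : ∀ {x} → LabelEntry π q x → l < x → NewNestings q → LabelEntry π′ q (suc l)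
  labelEntry-new entry l<x ν with nestingThroughNewArc ν
  ... | N , I₀≡i = inj₂ ( inject₁ i , ((N , I₀≡i) , start-bound old-bound (λ _ → ℕₚ.≤-refl))
                        , cong suc (sym (maxAbove-addTo-≥ ℕₚ.≤-refl)))
    where old-bound = λ M → ℕₚ.<⇒≤ (nestings-start-before i-max entry l<x M)

  nonNesting⇔ : ∀ {y} → NonNesting π (suc q) → LabelEntry π q y →
                (NonNesting π′ (suc q) ⇔ l < y)
  nonNesting⇔ {q = q} {y = y} ¬N entry = mk⇔ to λ l<y → nonNesting ¬N (¬newNestings-> entry l<y)
    where
    to : NonNesting π′ (suc q) → l < y
    to ¬N′ with l ℕₚ.<? y
    ... | yes l<y = l<y
    ... | no l≮y  = ⊥-elim (¬N′ (proj₁ (nestingThroughNewArc (newNestings-≤ entry (ℕₚ.≮⇒≥ l≮y)))))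

  -- For r < j the rightmost r-nesting lies right of i and survives, for r = j the new arc creates
  -- the rightmost one, starting at i, and for r > j neither happens.
  hasLabel-updLabel : ∀ {a : Fin (suc k) → ℕ} → HasLabel π (suc k) a → (j : Fin (suc k)) →
                      (∀ r → r Fin.< j → a r ≤ l) → l < a j →
                      HasLabel π′ (suc k) (updLabel a j (suc l))
  hasLabel-updLabel {k = k} {a = a} hl j a<j≤l l<aj r with Finₚ.<-cmp r j
  ... | tri< r<j _ _ = subst (LabelEntry π′ (toℕ r)) (sym (updLabel-< a j (suc l) r<j))
                             (labelEntry-≤ (hl r) (a<j≤l r r<j))
  ... | tri≈ _ refl _ = subst (LabelEntry π′ (toℕ r)) (sym (updLabel-≡ a j (suc l)))
                              (labelEntry-new (hl j) l<aj (newNestings-at j a<j≤l))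
    where
    newNestings-at : (j : Fin (suc k)) → (∀ r → r Fin.< j → a r ≤ l) → NewNestings (toℕ j)
    newNestings-at zero    _ = tt
    newNestings-at (suc j) a<j≤l =
      newNestings-≤ (HasLabel-inject₁ hl j) (a<j≤l (inject₁ j) (Finₚ.≤̄⇒inject₁< ℕₚ.≤-refl))
  ... | tri> _ _ j<r = subst (LabelEntry π′ (toℕ r)) (sym (updLabel-> a j (suc l) j<r))
                             (labelEntry-> (hl r) (l<a (ℕₚ.<⇒≤ j<r)) (¬newNestings-at r j<r))
    where
    l<a : ∀ {s} → j Fin.≤ s → l < a s
    l<a j≤s = ℕₚ.<-≤-trans l<aj (HasLabel-mono hl j≤s)
    ¬newNestings-at : ∀ r → j Fin.< r → ¬ NewNestings (toℕ r)
    ¬newNestings-at (suc r) j<r = ¬newNestings-> (HasLabel-inject₁ hl r) (l<a (Finₚ.<⇒≤pred j<r))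

blockMax-exists : (π : DecRel n) → ∀ l → 1 ≤ l → l ≤ numBlocks π → Σ (Fin n) (BlockMax π l)
blockMax-exists π (suc c) _ c<numBlocks with element-of-rank (isMax? π) c c<numBlocks
... | i , i-max , rank = i , i-max , cong suc rank

proposition1 : (k n : ℕ) (π : DecRel n) → IsSetPartition π
    → NonNesting π (suc k)
    → (a : Fin (suc k) → ℕ) → HasLabel π (suc k) a
    → (NonNesting (addSingleton π) (suc k)
       × HasLabel (addSingleton π) (suc k) (λ r → suc (a r)))
      × (∀ l → 1 ≤ l → l < a (fromℕ k) → Σ (Fin n) (BlockMax π l))
      × (∀ l i → BlockMax π l i
           → (NonNesting (addTo π i) (suc k) ⇔ l < a (fromℕ k)))
      × (∀ l i → BlockMax π l i → l < a zero
           → HasLabel (addTo π i) (suc k) (updLabel a zero (suc l)))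
      × (∀ (j : Fin k) l i → BlockMax π l i
           → a (inject₁ j) ≤ l → l < a (suc j)
           → HasLabel (addTo π i) (suc k) (updLabel a (suc j) (suc l)))
proposition1 k n π isPartition ¬N a hl =
    (AddSingleton.nonNesting π ¬N , AddSingleton.labelEntry π ∘ hl)
  , (λ l 1≤l l<aₘ → blockMax-exists π l 1≤l
                      (ℕₚ.≤-pred (ℕₚ.<-≤-trans l<aₘ (LabelEntry≤ (hl (fromℕ k))))))
  , (λ { _ _ (i-max , refl) → AddTo.nonNesting⇔ isPartition i-max ¬N (HasLabel-fromℕ hl) })
  , (λ { _ _ (i-max , refl) l<a₁ → AddTo.hasLabel-updLabel isPartition i-max hl zero (λ _ ()) l<a₁ })
  , λ { j _ _ (i-max , refl) aⱼ≤l l<aⱼ₊₁ →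
        AddTo.hasLabel-updLabel isPartition i-max hl (suc j)
          (λ r r<j → ℕₚ.≤-trans (HasLabel-mono hl (Finₚ.<⇒≤pred r<j)) aⱼ≤l) l<aⱼ₊₁ }
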